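{- Let $\mathcal{P}=(P,\le)$ be a poset which is N-dense and interval-finite. Then $\mathcal{L}(P)=\langle L(P),\subseteq,\emptyset,P,(\cdot)^\perp\rangle$, the family of closed subsets of $P$ ordered by inclusion with orthocomplementation $S\mapsto S^\perp$, is an orthomodular lattice; that is, for all closed sets $S\subseteq T$ one has $T = S\vee (T\wedge S^\perp)$, where $\wedge$ is intersection and the join of closed sets $U,V$ is $(U\cup V)^{\perp\perp}$.
   Context: For a poset $(P,\le)$, write $x<y$ for $x\le y, x\neq y$. Two elements are in relation $li$ if $x\le y$ or $y\le x$, and $x\ co\ y$ iff not $x\ li\ y$ (so $co$ is symmetric and irreflexive). For $S\subseteq P$, $S^\perp=\{x\in P \mid \forall y\in S:\ x\ co\ y\}$; $S$ is closed if $S=(S^\perp)^\perp$. The closed sets, ordered by inclusion, form a complete orthocomplemented lattice $L(P)$ with meet $=$ intersection, join $=$ closure of the union, and orthocomplement $S\mapsto S^\perp$. An orthomodular lattice is an orthocomplemented lattice satisfying $x\le y\Rightarrow y=x\vee(y\wedge x')$. The poset is interval-finite if $[x,y]=\{z\mid x\le z\le y\}$ is finite for all $x,y$. It is N-dense if for all $x,y,v,w\in P$: whenever $y<v$, $y<x$, $w<v$, $y\ co\ w$, $w\ co\ x$ and $x\ co\ v$, there exists $z\in P$ with $y<z<v$, $w\ co\ z$ and $z\ co\ x$. -}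

module Defs where

open import Level using (Level; _⊔_)
open import Data.Product using (Σ; ∃; _×_; _,_)
open import Data.Sum using (_⊎_)
open import Data.List using (List)
open import Data.List.Relation.Unary.Any using (Any)
open import Relation.Nullary using (¬_)
open import Relation.Unary using (Pred; _⊆_; _∪_; _∩_)
open import Relation.Binary.Bundles using (Poset)

module PosetNotions {c ℓ₁ ℓ₂ : Level} (𝒫 : Poset c ℓ₁ ℓ₂) where
  open Poset 𝒫 public using (Carrier; _≈_; _≤_)

  _<_ : Carrier → Carrier → Set (ℓ₁ ⊔ ℓ₂)
  x < y = (x ≤ y) × ¬ (x ≈ y)

  _li_ : Carrier → Carrier → Set ℓ₂
  x li y = (x ≤ y) ⊎ (y ≤ x)

  _co_ : Carrier → Carrier → Set ℓ₂
  x co y = ¬ (x li y)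

  _⊥ : {ℓ : Level} → Pred Carrier ℓ → Pred Carrier (c ⊔ ℓ ⊔ ℓ₂)
  (S ⊥) x = ∀ y → S y → x co y

  _≐_ : {ℓ ℓ' : Level} → Pred Carrier ℓ → Pred Carrier ℓ' → Set (c ⊔ ℓ ⊔ ℓ')
  S ≐ T = (S ⊆ T) × (T ⊆ S)

  Closed : {ℓ : Level} → Pred Carrier ℓ → Set (c ⊔ ℓ ⊔ ℓ₂)
  Closed S = S ≐ ((S ⊥) ⊥)

  _∨L_ : {ℓ ℓ' : Level} → Pred Carrier ℓ → Pred Carrier ℓ' → Pred Carrier (c ⊔ ℓ ⊔ ℓ' ⊔ ℓ₂)
  U ∨L V = ((U ∪ V) ⊥) ⊥

  _∧L_ : {ℓ ℓ' : Level} → Pred Carrier ℓ → Pred Carrier ℓ' → Pred Carrier (ℓ ⊔ ℓ')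
  U ∧L V = U ∩ V

  IntervalFinite : Set (c ⊔ ℓ₁ ⊔ ℓ₂)
  IntervalFinite = ∀ x y → Σ (List Carrier) λ xs →
    ∀ z → x ≤ z → z ≤ y → Any (z ≈_) xs

  NDense : Set (c ⊔ ℓ₁ ⊔ ℓ₂)
  NDense = ∀ x y v w → y < v → y < x → w < v → y co w → w co x → x co v →
    Σ Carrier λ z → (y < z) × (z < v) × (w co z) × (z co x)

-- If t ∈ T and x ∈ (S ∪ (T ∩ S⊥))⊥ were comparable, t could not be orthogonal to S, so t lies
-- below (or, dually, above) both x and some s ∈ S. Take z maximal in [t, x] among the elements
-- below S, and an element u covering z with u ≤ x (both exist by interval-finiteness). Maximality of
-- z puts u in S⊥. If some y ∈ T⊥ were comparable to u, it would lie strictly below u and form an N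
-- with z < s and z < u; N-density then yields an element strictly between z and u. Hence u ∈ T⊥⊥ = T,
-- so u ∈ T ∩ S⊥, contradicting u ≤ x.
module Submission where

open import Defs
open import Level using (Level)
open import Function using (_∘_)
open import Data.Product using (Σ; _×_; _,_; proj₁; proj₂)
open import Data.Sum using (inj₁; inj₂) renaming (swap to ⊎-swap)
open import Data.List using (List; []; _∷_)
open import Data.List.Relation.Unary.Any using (Any; tail)
open import Data.List.Relation.Unary.Any.Properties using (¬Any[])
open import Relation.Nullary using (¬_; yes; no)
open import Relation.Nullary.Decidable.Core using (¬¬-excluded-middle)
open import Relation.Unary using (Pred; _⊆_; _∪_; _∩_)
open import Relation.Binary.Bundles using (Poset)
import Relation.Binary.Properties.Poset as PosetProperties

module Basic {c ℓ₁ ℓ₂ : Level} (𝒫 : Poset c ℓ₁ ℓ₂) where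
  open PosetNotions 𝒫
  open Poset 𝒫 using (reflexive; trans; module Eq)
  open PosetProperties 𝒫 using (≥-poset; <-trans; <-irrefl)
  private module Op = PosetNotions ≥-poset

  co-sym : ∀ {x y} → x co y → y co x
  co-sym x-co-y = x-co-y ∘ ⊎-swap

  ⊥-antitone : ∀ {ℓ ℓ'} {A : Pred Carrier ℓ} {B : Pred Carrier ℓ'} →
    A ⊆ B → (B ⊥) ⊆ (A ⊥)
  ⊥-antitone A⊆B x∈B⊥ y y∈A = x∈B⊥ y (A⊆B y∈A)

  IsMaximal : ∀ {q} → Pred Carrier q → Pred Carrier _
  IsMaximal Q m = Q m × ∀ {w} → m < w → ¬ Q w

  ¬¬-maximal : ∀ {q} (Q : Pred Carrier q) (ys : List Carrier) {z : Carrier} → Q z →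
    (∀ {w} → z < w → Q w → Any (w ≈_) ys) → ¬ ¬ Σ Carrier (IsMaximal Q)
  ¬¬-maximal Q [] Qz listed noMax = noMax (_ , Qz , λ z<w Qw → ¬Any[] (listed z<w Qw))
  ¬¬-maximal Q (y ∷ ys) {z} Qz listed noMax =
    ¬¬-excluded-middle {A = Σ Carrier λ w → z < w × Q w × w ≈ y} λ where
      (yes (w , z<w , Qw , w≈y)) →
        ¬¬-maximal Q ys Qw
          (λ w<v Qv → tail (λ v≈y → <-irrefl (Eq.trans w≈y (Eq.sym v≈y)) w<v)
                           (listed (<-trans z<w w<v) Qv))
          noMax
      (no ¬above≈y) →
        ¬¬-maximal Q ys Qz
          (λ z<w Qw → tail (λ w≈y → ¬above≈y (_ , z<w , Qw , w≈y)) (listed z<w Qw))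
          noMax

  infix 4 _⋖_
  _⋖_ : Carrier → Carrier → Set _
  z ⋖ u = z < u × ∀ {w} → z < w → ¬ w < u

  cover-∈-⊥⊥ : NDense → ∀ {ℓ} {T : Pred Carrier ℓ} {t z u s} → T t → T s →
    t ≤ z → z ≤ s → s co u → z ⋖ u → ((T ⊥) ⊥) u
  cover-∈-⊥⊥ nd {t = t} {z} {u} {s} Tt Ts t≤z z≤s s-co-u (z<u , nothing-between) y y∈T⊥ =
    λ where
      (inj₁ u≤y) → y∈T⊥ t Tt (inj₂ (trans t≤u u≤y))
      (inj₂ y≤u) →
        let (_ , z<w , w<u , _) = nd s z u y z<u z<s (y≤u , y≉u) z-co-y (y∈T⊥ s Ts) s-co-u
        in nothing-between z<w w<u
    where
    t≤u : t ≤ u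
    t≤u = trans t≤z (proj₁ z<u)
    z<s : z < s
    z<s = z≤s , λ z≈s → s-co-u (inj₁ (trans (reflexive (Eq.sym z≈s)) (proj₁ z<u)))
    y≉u : ¬ y ≈ u
    y≉u y≈u = y∈T⊥ t Tt (inj₂ (trans t≤u (reflexive (Eq.sym y≈u))))
    z-co-y : z co y
    z-co-y (inj₁ z≤y) = y∈T⊥ t Tt (inj₂ (trans t≤z z≤y))
    z-co-y (inj₂ y≤z) = y∈T⊥ s Ts (inj₁ (trans y≤z z≤s))

  <⇒>ᵒ : ∀ {x y} → x < y → y Op.< x
  <⇒>ᵒ (x≤y , x≉y) = x≤y , x≉y ∘ Eq.sym

  >ᵒ⇒< : ∀ {x y} → x Op.< y → y < x
  >ᵒ⇒< (y≤x , x≉y) = y≤x , x≉y ∘ Eq.sym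

  -- Orthogonality in the dual poset is that of 𝒫 with the arguments swapped, definitionally.
  ⊥⇒⊥ᵒ : ∀ {ℓ} {S : Pred Carrier ℓ} → (S ⊥) ⊆ (S Op.⊥)
  ⊥⇒⊥ᵒ x∈S⊥ y y∈S = co-sym (x∈S⊥ y y∈S)

  ⊥ᵒ⇒⊥ : ∀ {ℓ} {S : Pred Carrier ℓ} → (S Op.⊥) ⊆ (S ⊥)
  ⊥ᵒ⇒⊥ x∈S⊥ y y∈S = co-sym (x∈S⊥ y y∈S)

  NDense-dual : NDense → Op.NDense
  NDense-dual nd x y v w y>v y>x w>v w-co-y x-co-w v-co-x
    with nd w v y x (>ᵒ⇒< y>v) (>ᵒ⇒< w>v) (>ᵒ⇒< y>x) v-co-x x-co-w w-co-y
  ... | z , v<z , z<y , x-co-z , z-co-w = z , <⇒>ᵒ z<y , <⇒>ᵒ v<z , z-co-w , x-co-z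

  IntervalFinite-dual : IntervalFinite → Op.IntervalFinite
  IntervalFinite-dual finite x y =
    proj₁ (finite y x) , λ z z≤x y≤z → proj₂ (finite y x) z y≤z z≤x

module Bounds {c ℓ₁ ℓ₂ : Level} (𝒫 : Poset c ℓ₁ ℓ₂) where
  open PosetNotions 𝒫
  open Poset 𝒫 using (refl; reflexive; trans; module Eq)
  open PosetProperties 𝒫 using (≥-poset)
  open Basic 𝒫
  private module Op = Basic ≥-poset

  ¬¬-cover : IntervalFinite → ∀ {z x} → z < x → ¬ ¬ Σ Carrier λ u → z ⋖ u × u ≤ x
  ¬¬-cover finite {z} {x} z<x noCover =
    Op.¬¬-maximal (λ u → z < u × u ≤ x) (proj₁ (finite z x)) (z<x , refl)
      (λ w<x (z<w , _) → proj₂ (finite z x) _ (proj₁ z<w) (proj₁ w<x))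
      λ (u , (z<u , u≤x) , minimal) →
        let nothing-between : ∀ {w} → z < w → ¬ w < u
            nothing-between z<w w<u = minimal (<⇒>ᵒ w<u) (z<w , trans (proj₁ w<u) u≤x)
        in noCover (u , (z<u , nothing-between) , u≤x)

  ¬common-lower-bound : NDense → IntervalFinite →
    ∀ {ℓ} {S T : Pred Carrier ℓ} → S ⊆ T → ((T ⊥) ⊥) ⊆ T →
    ∀ {t s x} → T t → S s → ((S ∪ (T ∩ (S ⊥))) ⊥) x → t ≤ x → ¬ t ≤ s
  ¬common-lower-bound nd finite {S = S} {T} S⊆T T-closed {t} {s} {x}
                      Tt Ss x∈⊥ t≤x t≤s =
    ¬¬-maximal BelowS (proj₁ (finite t x)) (refl , t≤x , s , Ss , t≤s)
      (λ _ (t≤w , w≤x , _) → proj₂ (finite t x) _ t≤w w≤x)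
      λ (z , (t≤z , z≤x , s′ , Ss′ , z≤s′) , maximal) →
        let z<x : z < x
            z<x = z≤x , λ z≈x →
              x∈⊥ s′ (inj₁ Ss′) (inj₁ (trans (reflexive (Eq.sym z≈x)) z≤s′))
        in ¬¬-cover finite z<x λ (u , z⋖u@(z<u , _) , u≤x) →
          let u∈S⊥ : (S ⊥) u
              u∈S⊥ = λ where
                s″ Ss″ (inj₁ u≤s″) →
                  maximal z<u (trans t≤z (proj₁ z<u) , u≤x , s″ , Ss″ , u≤s″)
                s″ Ss″ (inj₂ s″≤u) → x∈⊥ s″ (inj₁ Ss″) (inj₂ (trans s″≤u u≤x))
              u∈T : T u
              u∈T = T-closed
                (cover-∈-⊥⊥ nd Tt (S⊆T Ss′) t≤z z≤s′ (co-sym (u∈S⊥ s′ Ss′)) z⋖u)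
          in x∈⊥ u (inj₂ (u∈T , u∈S⊥)) (inj₂ u≤x)
    where
    BelowS : Pred Carrier _
    BelowS w = t ≤ w × w ≤ x × Σ Carrier λ s′ → S s′ × w ≤ s′

module Orthomodularity {c ℓ₁ ℓ₂ : Level} (𝒫 : Poset c ℓ₁ ℓ₂) where
  open PosetNotions 𝒫
  open Poset 𝒫 using (trans)
  open PosetProperties 𝒫 using (≥-poset)
  open Basic 𝒫
  open Bounds 𝒫
  private
    module Op = PosetNotions ≥-poset
    module OpBounds = Bounds ≥-poset

  ¬common-upper-bound : NDense → IntervalFinite →
    ∀ {ℓ} {S T : Pred Carrier ℓ} → S ⊆ T → ((T ⊥) ⊥) ⊆ T →
    ∀ {t s x} → T t → S s → ((S ∪ (T ∩ (S ⊥))) ⊥) x → x ≤ t → ¬ s ≤ t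
  ¬common-upper-bound nd finite {S = S} {T} S⊆T T-closed Tt Ss x∈⊥ =
    OpBounds.¬common-lower-bound (NDense-dual nd) (IntervalFinite-dual finite) S⊆T
      (T-closed ∘ ⊥-antitone ⊥⇒⊥ᵒ ∘ ⊥ᵒ⇒⊥) Tt Ss
      (⊥⇒⊥ᵒ (⊥-antitone dual-join-arguments x∈⊥))
    where
    dual-join-arguments : (S ∪ (T ∩ (S Op.⊥))) ⊆ (S ∪ (T ∩ (S ⊥)))
    dual-join-arguments (inj₁ Sy) = inj₁ Sy
    dual-join-arguments (inj₂ (Ty , y∈S⊥)) = inj₂ (Ty , ⊥ᵒ⇒⊥ y∈S⊥)

  comparable⇒∈⊥ : NDense → IntervalFinite →
    ∀ {ℓ} {S T : Pred Carrier ℓ} → S ⊆ T → ((T ⊥) ⊥) ⊆ T →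
    ∀ {t x} → T t → ((S ∪ (T ∩ (S ⊥))) ⊥) x → t li x → (S ⊥) t
  comparable⇒∈⊥ nd finite S⊆T T-closed Tt x∈⊥ = λ where
    (inj₁ t≤x) s Ss (inj₁ t≤s) →
      ¬common-lower-bound nd finite S⊆T T-closed Tt Ss x∈⊥ t≤x t≤s
    (inj₂ x≤t) s Ss (inj₂ s≤t) →
      ¬common-upper-bound nd finite S⊆T T-closed Tt Ss x∈⊥ x≤t s≤t
    (inj₁ t≤x) s Ss (inj₂ s≤t) → x∈⊥ s (inj₁ Ss) (inj₂ (trans s≤t t≤x))
    (inj₂ x≤t) s Ss (inj₁ t≤s) → x∈⊥ s (inj₁ Ss) (inj₁ (trans x≤t t≤s))

theorem1 : {c ℓ₁ ℓ₂ ℓ : Level} (𝒫 : Poset c ℓ₁ ℓ₂) →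
    let open PosetNotions 𝒫 in
    NDense → IntervalFinite →
    (S T : Pred Carrier ℓ) → Closed S → Closed T → S ⊆ T →
    T ≐ (S ∨L (T ∧L (S ⊥)))
theorem1 𝒫 nd finite S T _ (_ , T-closed) S⊆T = T⊆join , join⊆T
  where
  open PosetNotions 𝒫
  open Basic 𝒫 using (⊥-antitone)
  open Orthomodularity 𝒫 using (comparable⇒∈⊥)

  T⊆join : T ⊆ (S ∨L (T ∧L (S ⊥)))
  T⊆join Tt x x∈⊥ t-li-x =
    x∈⊥ _ (inj₂ (Tt , comparable⇒∈⊥ nd finite S⊆T T-closed Tt x∈⊥ t-li-x)) (⊎-swap t-li-x)

  join⊆T : (S ∨L (T ∧L (S ⊥))) ⊆ T
  join⊆T = T-closed ∘ ⊥-antitone (⊥-antitone S∪T∩S⊥⊆T)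
    where
    S∪T∩S⊥⊆T : (S ∪ (T ∩ (S ⊥))) ⊆ T
    S∪T∩S⊥⊆T (inj₁ Sy) = S⊆T Sy
    S∪T∩S⊥⊆T (inj₂ (Ty , _)) = Ty
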